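{- $\mathfrak b=\mathrm{cov}(I_L)$.
   Context: $\mathfrak b$ is the bounding number. $I_L$ is the $\sigma$-ideal on $\omega^\omega$ generated by the sets $A_g=\{f\in\omega^\omega: f(n)\in g(f\restriction n)\text{ for infinitely many } n\in\omega\}$, where $g$ ranges over all functions from $\omega^{<\omega}$ to $\omega$ (natural numbers identified with von Neumann ordinals, so $f(n)\in g(f\restriction n)$ means $f(n)<g(f\restriction n)$). $\mathrm{cov}(I)$ is the least size of a subfamily of $I$ whose union is $\omega^\omega$. -}

module Defs where

open import Data.Nat using (ℕ; _≤_; _<_)
open import Data.List using (List; map; upTo)
open import Data.Product using (Σ; ∃; _×_)
open import Relation.Nullary using (¬_)

Baire : Set
Baire = ℕ → ℕ

restrict : Baire → ℕ → List ℕ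
restrict f n = map f (upTo n)

A : (List ℕ → ℕ) → Baire → Set
A g f = ∀ N → ∃ λ n → N ≤ n × f n < g (restrict f n)

-- membership in the σ-ideal I_L generated by the sets A_g:
-- S is contained in a countable union of generators
InIL : (Baire → Set) → Set
InIL S = Σ (ℕ → List ℕ → ℕ) λ gs → ∀ f → S f → ∃ λ k → A (gs k) f

_≤*_ : Baire → Baire → Set
f ≤* h = ∃ λ N → ∀ n → N ≤ n → f n ≤ h n

Unbounded : {X : Set} → (X → Baire) → Set
Unbounded {X} F = ¬ (∃ λ h → ∀ x → F x ≤* h)

Covers : {X : Set} → (X → Baire → Set) → Set
Covers {X} S = ∀ f → ∃ λ x → S x f

{-# OPTIONS --safe #-}
module Submission where

open import Defs
open import Level using (0ℓ)
open import Data.Product using (Σ; _×_; _,_; proj₁; proj₂)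
open import Function using (_∘′_)
open import Function.Bundles using (_⇔_; mk⇔)
open import Axiom.ExcludedMiddle using (ExcludedMiddle)
open import Axiom.DoubleNegationElimination using (DoubleNegationElimination; em⇒dne)
open import Data.Nat
open import Data.Nat.Properties
open import Data.List using (List; []; _∷_; length; upTo; applyUpTo)
open import Data.List.Properties using (length-map; length-upTo)
open import Data.List.Extrema.Nat using (max; xs≤max)
open import Data.List.Membership.Propositional.Properties using (∈-applyUpTo⁺)
open import Data.List.Relation.Unary.All as All using (All; []; _∷_)
open import Data.List.Relation.Unary.All.Properties using (map⁺; all-upTo)
open import Relation.Nullary using (¬_)
open import Relation.Binary.PropositionalEquality using (_≡_; refl; sym; trans; subst)

-- If F is unbounded, the sets {f : F x ≰* f} cover ω^ω, and
-- each lies in the single generator A_g with g s = F x (length s).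
-- Conversely, if every S x lies in ⋃ₖ A_{gₖ}, let b_x m bound gₖ s for all
-- k ≤ m and all s of length ≤ m with entries ≤ m. A function h dominating
-- every b_x would yield f with f (n+1) > h (f n), which escapes every A_{gₖ}
-- since f ↾ (n+1) has length and entries ≤ f n; but f lies in some S x.

length-restrict : ∀ f n → length (restrict f n) ≡ n
length-restrict f n = trans (length-map f (upTo n)) (length-upTo n)

restrict⁺ : ∀ {P : ℕ → Set} f n → (∀ {i} → i < n → P (f i)) → All P (restrict f n)
restrict⁺ f n Pf = map⁺ (All.map Pf (all-upTo n))

module _ (dne : DoubleNegationElimination 0ℓ) where

  ≰*⇒A-length : ∀ {F f} → ¬ (F ≤* f) → A (λ s → F (length s)) f
  ≰*⇒A-length {F} {f} F≰*f N = dne λ ¬often →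
    F≰*f (N , λ n N≤n → ≮⇒≥ λ fn<Fn →
      ¬often (n , N≤n , subst (λ l → f n < F l) (sym (length-restrict f n)) fn<Fn))

  unbounded⇒covered : {X : Set} → Σ (X → Baire) Unbounded →
    Σ (X → Baire → Set) λ S → ((x : X) → InIL (S x)) × Covers S
  unbounded⇒covered {X} (F , unbounded) = S , inIL , covers
    where
    S : X → Baire → Set
    S x f = ¬ (F x ≤* f)
    inIL : ∀ x → InIL (S x)
    inIL x = (λ _ s → F x (length s)) , λ f F≰*f → 0 , ≰*⇒A-length F≰*f
    covers : Covers S
    covers f = dne λ uncovered →
      unbounded (f , λ x → dne λ F≰*f → uncovered (x , F≰*f))

maxUpTo : (ℕ → ℕ) → ℕ → ℕ
maxUpTo φ m = max 0 (applyUpTo φ (suc m))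

≤-maxUpTo : ∀ φ {a m} → a ≤ m → φ a ≤ maxUpTo φ m
≤-maxUpTo φ {m = m} a≤m =
  All.lookup (xs≤max 0 (applyUpTo φ (suc m))) (∈-applyUpTo⁺ φ (s≤s a≤m))

supBelow : (List ℕ → ℕ) → ℕ → ℕ → ℕ
supBelow g m zero = g []
supBelow g m (suc d) = g [] ⊔ maxUpTo (λ a → supBelow (λ s → g (a ∷ s)) m d) m

≤-supBelow : ∀ g {m d} s → All (_≤ m) s → length s ≤ d → g s ≤ supBelow g m d
≤-supBelow g {d = zero} [] [] _ = ≤-refl
≤-supBelow g {d = suc d} [] [] _ = m≤m⊔n (g []) _
≤-supBelow g {m} {suc d} (a ∷ s) (a≤m ∷ s≤m) (s≤s |s|≤d) = begin
  g (a ∷ s)                                        ≤⟨ ≤-supBelow (λ t → g (a ∷ t)) s s≤m |s|≤d ⟩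
  supBelow (λ t → g (a ∷ t)) m d                   ≤⟨ ≤-maxUpTo (λ b → supBelow (λ t → g (b ∷ t)) m d) a≤m ⟩
  maxUpTo (λ b → supBelow (λ t → g (b ∷ t)) m d) m ≤⟨ m≤n⊔m (g []) _ ⟩
  supBelow g m (suc d)                             ∎
  where open ≤-Reasoning

bound : (ℕ → List ℕ → ℕ) → Baire
bound gs m = maxUpTo (λ k → supBelow (gs k) m m) m

≤-bound : ∀ gs {k m} s → k ≤ m → All (_≤ m) s → length s ≤ m → gs k s ≤ bound gs m
≤-bound gs {k} {m} s k≤m s≤m |s|≤m =
  ≤-trans (≤-supBelow (gs k) s s≤m |s|≤m) (≤-maxUpTo (λ k → supBelow (gs k) m m) k≤m)

-- Starting at 1 makes n < jump h n, so jump h ↾ (n+1) has length ≤ jump h n.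
jump : Baire → Baire
jump h zero = 1
jump h (suc n) = suc (jump h n + h (jump h n))

n<jump : ∀ h n → n < jump h n
n<jump h zero = s≤s z≤n
n<jump h (suc n) = s≤s (≤-trans (n<jump h n) (m≤m+n _ _))

jump-outgrows : ∀ h n → h (jump h n) < jump h (suc n)
jump-outgrows h n = s≤s (m≤n+m _ _)

jump-mono : ∀ h {i n} → i ≤ n → jump h i ≤ jump h n
jump-mono h = mono′ ∘′ ≤⇒≤′
  where
  mono′ : ∀ {i n} → i ≤′ n → jump h i ≤ jump h n
  mono′ ≤′-refl = ≤-refl
  mono′ (≤′-step i≤′n) = ≤-trans (mono′ i≤′n) (≤-trans (m≤m+n _ _) (n≤1+n _))

jump-∉-A : ∀ gs {h} → bound gs ≤* h → ∀ k → ¬ A (gs k) (jump h)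
jump-∉-A gs {h} (N , dominated) k often with often (suc (N + k))
... | suc n , s≤s N+k≤n , below = <-irrefl refl (begin-strict
  jump h (suc n)                   <⟨ below ⟩
  gs k (restrict (jump h) (suc n)) ≤⟨ ≤-bound gs _ (≤N+k⇒≤m (m≤n+m k N)) entries≤m length≤m ⟩
  bound gs m                       ≤⟨ dominated m (≤N+k⇒≤m (m≤m+n N k)) ⟩
  h m                              <⟨ jump-outgrows h n ⟩
  jump h (suc n)                   ∎)
  where
  open ≤-Reasoning
  m = jump h n
  ≤N+k⇒≤m : ∀ {j} → j ≤ N + k → j ≤ m
  ≤N+k⇒≤m j≤N+k = ≤-trans j≤N+k (≤-trans N+k≤n (<⇒≤ (n<jump h n)))
  entries≤m : All (_≤ m) (restrict (jump h) (suc n))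
  entries≤m = restrict⁺ (jump h) (suc n) λ i<1+n → jump-mono h (s≤s⁻¹ i<1+n)
  length≤m : length (restrict (jump h) (suc n)) ≤ m
  length≤m = subst (_≤ m) (sym (length-restrict (jump h) (suc n))) (n<jump h n)

covered⇒unbounded : {X : Set} →
  (Σ (X → Baire → Set) λ S → ((x : X) → InIL (S x)) × Covers S) → Σ (X → Baire) Unbounded
covered⇒unbounded (S , inIL , covers) = (λ x → bound (proj₁ (inIL x))) , unbounded
  where
  unbounded : Unbounded (λ x → bound (proj₁ (inIL x)))
  unbounded (h , dominated) with covers (jump h)
  ... | x , Sx with proj₂ (inIL x) (jump h) Sx
  ... | k , often = jump-∉-A (proj₁ (inIL x)) (dominated x) k often

lemma3p2p1 : ExcludedMiddle 0ℓ → (X : Set) →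
    (Σ (X → Baire) Unbounded) ⇔ (Σ (X → Baire → Set) λ S → ((x : X) → InIL (S x)) × Covers S)
lemma3p2p1 em X = mk⇔ (unbounded⇒covered (em⇒dne em)) covered⇒unbounded
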